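{- Let $m,n\ge1$ and let \[ \mathcal S_m=\{(m,0)\}\cup\{(\delta_x,\delta_y)\in\mathbb{Z}^2:\ \delta_x<m\text{ and }\delta_x+\delta_y\le m\}. \] There is a bijection between intervals of $\mathbb{D}_{m,n}$ and walks in $\mathbb{N}^2$ starting from $(0,0)$ consisting of $n-1$ steps from $\mathcal S_m$, such that a walk ending at $(i,j)$ corresponds to an interval $[P,Q]$ where $P$ and $Q$ have final descent lengths $m+i$ and $m+i+j$ respectively. Consequently, there is also a bijection between intervals of $\mathbb{D}_{m,n}$ and walks in $\mathbb{N}^2$ of length $n$ with steps in $\mathcal S_m$ starting and ending at $(0,0)$.
   Context: Dyck paths of size $N$: lattice paths from $(0,0)$ with $N$ steps $U=(1,1)$ and $N$ steps $D=(1,-1)$, ending on the $x$-axis, never below it. A descent is a maximal run of down steps; the final descent is the last one. $\mathbb{D}_N$: Dyck paths of size $N$ ordered by the reflexive-transitive closure of replacing a factor $DU^kD$ ($k\ge1$) by $U^kDD$. $\mathbb{D}_{m,n}$: Dyck paths of size $mn$ whose maximal runs of up steps all have length a multiple of $m$, with the order induced from $\mathbb{D}_{mn}$. An interval is a pair $P\le Q$. A walk in $\mathbb{N}^2$ is a sequence of lattice points all with nonnegative coordinates, consecutive differences being the steps. -}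

module Defs where

open import Data.Bool using (Bool; true; false; T)
open import Data.Nat as ℕ using (ℕ; zero; suc; _*_)
open import Data.Nat.Divisibility using (_∣_)
open import Data.Integer as ℤ using (ℤ; +_; 0ℤ)
open import Data.List using (List; []; _∷_; _++_; replicate; reverse; length)
open import Data.List.Relation.Unary.All using (All)
open import Data.Product using (Σ; _×_; _,_; proj₁; proj₂)
open import Data.Sum using (_⊎_)
open import Data.Unit using (⊤)
open import Relation.Binary.PropositionalEquality using (_≡_)
import Relation.Binary.PropositionalEquality as Eq
open import Relation.Binary.Bundles using (Setoid)
import Relation.Binary.Construct.On as On
open import Relation.Binary.Construct.Closure.ReflexiveTransitive using (Star)
open import Level using (0ℓ)

Path : Set
Path = List Bool

pattern U = true
pattern D = false

dyckFrom : ℕ → Path → Bool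
dyckFrom zero    []      = true
dyckFrom (suc h) []      = false
dyckFrom h       (U ∷ p) = dyckFrom (suc h) p
dyckFrom zero    (D ∷ p) = false
dyckFrom (suc h) (D ∷ p) = dyckFrom h p

-- Dyck path of size N: N up steps, N down steps, never below the x-axis.
-- (length 2N + ending at height 0 forces N of each.)
IsDyck : ℕ → Path → Set
IsDyck N p = length p ≡ 2 * N × T (dyckFrom 0 p)

upRunsAcc : ℕ → Path → List ℕ
upRunsAcc zero    []      = []
upRunsAcc (suc c) []      = suc c ∷ []
upRunsAcc c       (U ∷ p) = upRunsAcc (suc c) p
upRunsAcc zero    (D ∷ p) = upRunsAcc zero p
upRunsAcc (suc c) (D ∷ p) = suc c ∷ upRunsAcc zero p

upRuns : Path → List ℕ
upRuns = upRunsAcc zero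

leadingD : Path → ℕ
leadingD (D ∷ p) = suc (leadingD p)
leadingD _       = zero

finalDescent : Path → ℕ
finalDescent p = leadingD (reverse p)

data _⋖_ : Path → Path → Set where
  move : ∀ (A B : Path) (k : ℕ) →
         (A ++ D ∷ replicate (suc k) U ++ D ∷ B) ⋖ (A ++ replicate (suc k) U ++ D ∷ D ∷ B)

-- Order of 𝔻_N (and, by restriction, of 𝔻_{m,n}): reflexive-transitive closure.
_≤D_ : Path → Path → Set
_≤D_ = Star _⋖_

DMN : ℕ → ℕ → Set
DMN m n = Σ Path (λ p → IsDyck (m * n) p × All (m ∣_) (upRuns p))

Interval : ℕ → ℕ → Set
Interval m n = Σ (DMN m n) λ P → Σ (DMN m n) λ Q → proj₁ P ≤D proj₁ Q

lowerPath : ∀ {m n} → Interval m n → Path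
lowerPath (P , _ , _) = proj₁ P

upperPath : ∀ {m n} → Interval m n → Path
upperPath (_ , Q , _) = proj₁ Q

-- Intervals are identified when their endpoints are equal (proofs irrelevant).
IntervalSetoid : ℕ → ℕ → Setoid 0ℓ 0ℓ
IntervalSetoid m n =
  On.setoid (Eq.setoid (Path × Path)) (λ (I : Interval m n) → lowerPath I , upperPath I)

Point : Set
Point = ℤ × ℤ

_⊕_ : Point → Point → Point
(a , b) ⊕ (c , d) = (a ℤ.+ c , b ℤ.+ d)

InS : ℕ → Point → Set
InS m (dx , dy) = (dx ≡ + m × dy ≡ 0ℤ) ⊎ (dx ℤ.< + m × dx ℤ.+ dy ℤ.≤ + m)

StaysIn : Point → List Point → Set
StaysIn p []       = ⊤
StaysIn p (s ∷ ss) = (0ℤ ℤ.≤ proj₁ (p ⊕ s) × 0ℤ ℤ.≤ proj₂ (p ⊕ s)) × StaysIn (p ⊕ s) ss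

endFrom : Point → List Point → Point
endFrom p []       = p
endFrom p (s ∷ ss) = endFrom (p ⊕ s) ss

origin : Point
origin = (0ℤ , 0ℤ)

Walk : ℕ → ℕ → Set
Walk m k = Σ (List Point) λ ss → length ss ≡ k × All (InS m) ss × StaysIn origin ss

endpoint : ∀ {m k} → Walk m k → Point
endpoint (ss , _) = endFrom origin ss

WalkSetoid : ℕ → ℕ → Setoid 0ℓ 0ℓ
WalkSetoid m k = On.setoid (Eq.setoid (List Point)) (λ (w : Walk m k) → proj₁ w)

ClosedWalk : ℕ → ℕ → Set
ClosedWalk m k = Σ (Walk m k) λ w → endpoint w ≡ origin

ClosedWalkSetoid : ℕ → ℕ → Setoid 0ℓ 0ℓ
ClosedWalkSetoid m k = On.setoid (Eq.setoid (List Point)) (λ (w : ClosedWalk m k) → proj₁ (proj₁ w))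

-- Read paths backwards, so that the final descent becomes the run of leading D's.  Every path of
-- 𝔻_{m,k+1} arises from a unique path of 𝔻_{m,k} by inserting a peak U^m D^m into its final descent,
-- at some height a and after c of its final down steps; and two such paths form an interval exactly when
-- the smaller paths do, a_P ≤ a_Q, and c_P = 0 forces c_Q = 0.  Recording each insertion as the step
-- (m − c_P , c_P − c_Q) ∈ 𝒮_m turns an interval of 𝔻_{m,n} into a walk with n − 1 steps whose position is
-- (a_P , a_Q − a_P), i.e. the two final descents minus m.  Appending the step back to the origin, which
-- always lies in 𝒮_m, identifies these walks with the closed walks of length n.

module Submission where

open import Defs
open import Data.Bool using (T)
open import Data.Nat using (ℕ; zero; suc; _+_; _*_; _∸_; _≤_; z≤n; s≤s)
open import Data.Nat.Properties
open import Data.Nat.Divisibility using (_∣_; ∣m∣n⇒∣m+n; ∣m+n∣m⇒∣n; ∣-refl; ∣⇒≤)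
open import Data.Nat.Tactic.RingSolver using (solve-∀)
open import Data.Integer as ℤ using (+_; 0ℤ)
import Data.Integer.Properties as ℤ
open import Data.Integer.Tactic.RingSolver using () renaming (solve-∀ to solveℤ-∀)
open import Data.List
  using (List; []; _∷_; _++_; _∷ʳ_; replicate; reverse; length; [_]; foldl; initLast; _∷ʳ′_)
open import Data.List.Properties
  using (++-assoc; reverse-++; unfold-reverse; reverse-involutive; length-++; length-replicate;
         length-reverse; ++-identityʳ; ++-cancelˡ; foldl-++; ∷-injectiveʳ)
open import Data.List.Relation.Unary.All using (All; []; _∷_)
open import Data.List.Relation.Unary.All.Properties using (++⁺; ++⁻ˡ)
open import Data.Product using (Σ; ∃; ∃₂; _×_; _,_; proj₁; proj₂)
open import Data.Sum using (_⊎_; inj₁; inj₂)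
open import Data.Unit using (⊤; tt)
open import Data.Empty using (⊥; ⊥-elim)
open import Function using (_⇔_; mk⇔; Equivalence)
open import Function.Bundles using (Bijection; Inverse)
open import Function.Properties.Inverse using (Inverse⇒Bijection)
import Function.Construct.Composition as Compose
import Function.Construct.Symmetry as Symmetry
import Relation.Binary.Construct.On as On
open import Relation.Binary.PropositionalEquality hiding ([_])
open import Relation.Binary.Construct.Closure.ReflexiveTransitive using (Star; ε; _◅_; _◅◅_; gmap)

Ds Us : ℕ → Path
Ds n = replicate n D
Us n = replicate n U

module _ {A : Set} (x : A) where

  replicate-∷ : ∀ n xs → replicate n x ++ x ∷ xs ≡ x ∷ replicate n x ++ xs
  replicate-∷ zero    xs = refl
  replicate-∷ (suc n) xs = cong (x ∷_) (replicate-∷ n xs)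

  replicate-+-++ : ∀ a b xs → replicate (a + b) x ++ xs ≡ replicate a x ++ replicate b x ++ xs
  replicate-+-++ zero    b xs = refl
  replicate-+-++ (suc a) b xs = cong (x ∷_) (replicate-+-++ a b xs)

  reverse-replicate : ∀ n → reverse (replicate n x) ≡ replicate n x
  reverse-replicate zero    = refl
  reverse-replicate (suc n) = begin
    reverse (x ∷ replicate n x)  ≡⟨ unfold-reverse x (replicate n x) ⟩
    reverse (replicate n x) ∷ʳ x ≡⟨ cong (_∷ʳ x) (reverse-replicate n) ⟩
    replicate n x ∷ʳ x           ≡⟨ replicate-∷ n [] ⟩
    x ∷ replicate n x ++ []      ≡⟨ cong (x ∷_) (++-identityʳ (replicate n x)) ⟩
    x ∷ replicate n x            ∎
    where open ≡-Reasoning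

  reverse-replicate-++ : ∀ n xs → reverse (replicate n x ++ xs) ≡ reverse xs ++ replicate n x
  reverse-replicate-++ n xs = trans (reverse-++ (replicate n x) xs) (cong (reverse xs ++_) (reverse-replicate n))

  length-replicate-++ : ∀ n xs → length (replicate n x ++ xs) ≡ n + length xs
  length-replicate-++ n xs = trans (length-++ (replicate n x)) (cong (_+ length xs) (length-replicate n))

reverse-++-∷ : ∀ {A : Set} (xs : List A) x ys → reverse (xs ++ x ∷ ys) ≡ reverse ys ++ x ∷ reverse xs
reverse-++-∷ xs x ys = begin
  reverse (xs ++ x ∷ ys)             ≡⟨ reverse-++ xs (x ∷ ys) ⟩
  reverse (x ∷ ys) ++ reverse xs     ≡⟨ cong (_++ reverse xs) (unfold-reverse x ys) ⟩
  (reverse ys ∷ʳ x) ++ reverse xs    ≡⟨ ++-assoc (reverse ys) [ x ] (reverse xs) ⟩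
  reverse ys ++ x ∷ reverse xs       ∎
  where open ≡-Reasoning

NoHeadD NoHeadU : Path → Set
NoHeadD (D ∷ _) = ⊥
NoHeadD _       = ⊤
NoHeadU (U ∷ _) = ⊥
NoHeadU _       = ⊤

dropD : Path → Path
dropD (D ∷ p) = dropD p
dropD p       = p

leadingU : Path → ℕ
leadingU (U ∷ p) = suc (leadingU p)
leadingU _       = zero

dropU : Path → Path
dropU (U ∷ p) = dropU p
dropU p       = p

Ds-leadingD-dropD : ∀ p → p ≡ Ds (leadingD p) ++ dropD p
Ds-leadingD-dropD []      = refl
Ds-leadingD-dropD (U ∷ p) = refl
Ds-leadingD-dropD (D ∷ p) = cong (D ∷_) (Ds-leadingD-dropD p)

Us-leadingU-dropU : ∀ p → p ≡ Us (leadingU p) ++ dropU p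
Us-leadingU-dropU []      = refl
Us-leadingU-dropU (D ∷ p) = refl
Us-leadingU-dropU (U ∷ p) = cong (U ∷_) (Us-leadingU-dropU p)

dropD-NoHeadD : ∀ p → NoHeadD (dropD p)
dropD-NoHeadD []      = tt
dropD-NoHeadD (U ∷ p) = tt
dropD-NoHeadD (D ∷ p) = dropD-NoHeadD p

dropU-NoHeadU : ∀ p → NoHeadU (dropU p)
dropU-NoHeadU []      = tt
dropU-NoHeadU (D ∷ p) = tt
dropU-NoHeadU (U ∷ p) = dropU-NoHeadU p

leadingD-Ds-++ : ∀ n {p} → NoHeadD p → leadingD (Ds n ++ p) ≡ n
leadingD-Ds-++ zero    {[]}    _ = refl
leadingD-Ds-++ zero    {U ∷ p} _ = refl
leadingD-Ds-++ (suc n) h         = cong suc (leadingD-Ds-++ n h)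

dropD-Ds-++ : ∀ n {p} → NoHeadD p → dropD (Ds n ++ p) ≡ p
dropD-Ds-++ zero    {[]}    _ = refl
dropD-Ds-++ zero    {U ∷ p} _ = refl
dropD-Ds-++ (suc n) h         = dropD-Ds-++ n h

leadingU-Us-++ : ∀ n p → leadingU (Us n ++ p) ≡ n + leadingU p
leadingU-Us-++ zero    p = refl
leadingU-Us-++ (suc n) p = cong suc (leadingU-Us-++ n p)

dropU-Us-++ : ∀ n p → dropU (Us n ++ p) ≡ dropU p
dropU-Us-++ zero    p = refl
dropU-Us-++ (suc n) p = dropU-Us-++ n p

Ds-++-injective : ∀ {n n′ p p′} → NoHeadD p → NoHeadD p′ →
  Ds n ++ p ≡ Ds n′ ++ p′ → n ≡ n′ × p ≡ p′
Ds-++-injective {n} {n′} h h′ e =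
  trans (sym (leadingD-Ds-++ n h)) (trans (cong leadingD e) (leadingD-Ds-++ n′ h′)) ,
  trans (sym (dropD-Ds-++ n h)) (trans (cong dropD e) (dropD-Ds-++ n′ h′))

infix 4 _⋖ʳ_ _≤ʳ_

-- The order of 𝔻_N read on reversed paths, where a move D U^k D ↦ U^k D D becomes D U^k D ↦ D D U^k.
data _⋖ʳ_ : Path → Path → Set where
  here  : ∀ k p → D ∷ Us (suc k) ++ D ∷ p ⋖ʳ D ∷ D ∷ Us (suc k) ++ p
  there : ∀ b {p q} → p ⋖ʳ q → b ∷ p ⋖ʳ b ∷ q

_≤ʳ_ : Path → Path → Set
_≤ʳ_ = Star _⋖ʳ_

⋖ʳ-prefix : ∀ xs {p q} → p ⋖ʳ q → xs ++ p ⋖ʳ xs ++ q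
⋖ʳ-prefix []       st = st
⋖ʳ-prefix (b ∷ xs) st = there b (⋖ʳ-prefix xs st)

reverse-move-source : ∀ A B k →
  reverse (A ++ D ∷ Us (suc k) ++ D ∷ B) ≡ reverse B ++ D ∷ Us (suc k) ++ D ∷ reverse A
reverse-move-source A B k = begin
  reverse (A ++ D ∷ Us (suc k) ++ D ∷ B)
    ≡⟨ reverse-++-∷ A D _ ⟩
  reverse (Us (suc k) ++ D ∷ B) ++ D ∷ reverse A
    ≡⟨ cong (_++ D ∷ reverse A) (reverse-++-∷ (Us (suc k)) D B) ⟩
  (reverse B ++ D ∷ reverse (Us (suc k))) ++ D ∷ reverse A
    ≡⟨ ++-assoc (reverse B) _ _ ⟩
  reverse B ++ D ∷ reverse (Us (suc k)) ++ D ∷ reverse A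
    ≡⟨ cong (λ u → reverse B ++ D ∷ u ++ D ∷ reverse A) (reverse-replicate U (suc k)) ⟩
  reverse B ++ D ∷ Us (suc k) ++ D ∷ reverse A ∎
  where open ≡-Reasoning

reverse-move-target : ∀ A B k →
  reverse (A ++ Us (suc k) ++ D ∷ D ∷ B) ≡ reverse B ++ D ∷ D ∷ Us (suc k) ++ reverse A
reverse-move-target A B k = begin
  reverse (A ++ Us (suc k) ++ D ∷ D ∷ B)
    ≡⟨ reverse-++ A _ ⟩
  reverse (Us (suc k) ++ D ∷ D ∷ B) ++ reverse A
    ≡⟨ cong (_++ reverse A) (reverse-++-∷ (Us (suc k)) D (D ∷ B)) ⟩
  (reverse (D ∷ B) ++ D ∷ reverse (Us (suc k))) ++ reverse A
    ≡⟨ cong (λ b → (b ++ D ∷ reverse (Us (suc k))) ++ reverse A) (unfold-reverse D B) ⟩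
  ((reverse B ∷ʳ D) ++ D ∷ reverse (Us (suc k))) ++ reverse A
    ≡⟨ cong (_++ reverse A) (++-assoc (reverse B) [ D ] _) ⟩
  (reverse B ++ D ∷ D ∷ reverse (Us (suc k))) ++ reverse A
    ≡⟨ ++-assoc (reverse B) _ _ ⟩
  reverse B ++ D ∷ D ∷ reverse (Us (suc k)) ++ reverse A
    ≡⟨ cong (λ u → reverse B ++ D ∷ D ∷ u ++ reverse A) (reverse-replicate U (suc k)) ⟩
  reverse B ++ D ∷ D ∷ Us (suc k) ++ reverse A ∎
  where open ≡-Reasoning

⋖⇒⋖ʳ : ∀ {p q} → p ⋖ q → reverse p ⋖ʳ reverse q
⋖⇒⋖ʳ (move A B k) rewrite reverse-move-source A B k | reverse-move-target A B k =
  ⋖ʳ-prefix (reverse B) (here k (reverse A))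

⋖ʳ-shape : ∀ {p q} → p ⋖ʳ q →
  ∃ λ X → ∃₂ λ k A → p ≡ X ++ D ∷ Us (suc k) ++ D ∷ A × q ≡ X ++ D ∷ D ∷ Us (suc k) ++ A
⋖ʳ-shape (here k A) = [] , k , A , refl , refl
⋖ʳ-shape (there b st) with ⋖ʳ-shape st
... | X , k , A , refl , refl = b ∷ X , k , A , refl , refl

⋖ʳ⇒⋖ : ∀ {p q} → p ⋖ʳ q → reverse p ⋖ reverse q
⋖ʳ⇒⋖ st with ⋖ʳ-shape st
... | X , k , A , refl , refl =
  subst₂ _⋖_ (sym (reverse-move-source X A k)) target (move (reverse A) (reverse X) k)
  where
  open ≡-Reasoning
  target : reverse A ++ Us (suc k) ++ D ∷ D ∷ reverse X ≡ reverse (X ++ D ∷ D ∷ Us (suc k) ++ A)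
  target = begin
    reverse A ++ Us (suc k) ++ D ∷ D ∷ reverse X
      ≡⟨ sym (reverse-involutive _) ⟩
    reverse (reverse (reverse A ++ Us (suc k) ++ D ∷ D ∷ reverse X))
      ≡⟨ cong reverse (reverse-move-target (reverse A) (reverse X) k) ⟩
    reverse (reverse (reverse X) ++ D ∷ D ∷ Us (suc k) ++ reverse (reverse A))
      ≡⟨ cong₂ (λ x a → reverse (x ++ D ∷ D ∷ Us (suc k) ++ a))
               (reverse-involutive X) (reverse-involutive A) ⟩
    reverse (X ++ D ∷ D ∷ Us (suc k) ++ A) ∎

≤D⇒≤ʳ : ∀ {p q} → p ≤D q → reverse p ≤ʳ reverse q
≤D⇒≤ʳ = gmap reverse ⋖⇒⋖ʳ

≤ʳ⇒≤D : ∀ {p q} → p ≤ʳ q → reverse p ≤D reverse q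
≤ʳ⇒≤D = gmap reverse ⋖ʳ⇒⋖

⋖ʳ-leadingD-mono : ∀ {p q} → p ⋖ʳ q → leadingD p ≤ leadingD q
⋖ʳ-leadingD-mono (here k p)   = s≤s z≤n
⋖ʳ-leadingD-mono (there U st) = z≤n
⋖ʳ-leadingD-mono (there D st) = s≤s (⋖ʳ-leadingD-mono st)

≤ʳ-leadingD-mono : ∀ {p q} → p ≤ʳ q → leadingD p ≤ leadingD q
≤ʳ-leadingD-mono ε          = ≤-refl
≤ʳ-leadingD-mono (st ◅ sts) = ≤-trans (⋖ʳ-leadingD-mono st) (≤ʳ-leadingD-mono sts)

Ds-++-≤ʳ⇒≤ : ∀ {n n′ p p′} → NoHeadD p → NoHeadD p′ → Ds n ++ p ≤ʳ Ds n′ ++ p′ → n ≤ n′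
Ds-++-≤ʳ⇒≤ {n} {n′} h h′ le =
  subst₂ _≤_ (leadingD-Ds-++ n h) (leadingD-Ds-++ n′ h′) (≤ʳ-leadingD-mono le)

⋖ʳ-NoHeadD : ∀ {p q} → p ⋖ʳ q → NoHeadD p → NoHeadD q
⋖ʳ-NoHeadD (there U _) _ = tt

⋖ʳ-Ds-++ : ∀ n p {q} → NoHeadD p → Ds n ++ p ⋖ʳ q →
  (∃₂ λ n′ k → ∃ λ A → n ≡ suc n′ × p ≡ Us (suc k) ++ D ∷ A ×
     q ≡ Ds (suc (suc n′)) ++ Us (suc k) ++ A)
  ⊎ (∃ λ p′ → q ≡ Ds n ++ p′ × p ⋖ʳ p′)
⋖ʳ-Ds-++ zero          p h st                = inj₂ (_ , refl , st)
⋖ʳ-Ds-++ (suc zero)    _ h (here k A)        = inj₁ (0 , k , A , refl , refl , refl)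
⋖ʳ-Ds-++ (suc zero)    p h (there _ st)      = inj₂ (_ , refl , st)
⋖ʳ-Ds-++ (suc (suc n)) p h (there _ st) with ⋖ʳ-Ds-++ (suc n) p h st
... | inj₁ (n′ , k , A , refl , refl , refl) = inj₁ (suc n′ , k , A , refl , refl , refl)
... | inj₂ (p′ , refl , st′)                 = inj₂ (p′ , refl , st′)

⋖ʳ-Us-++ : ∀ n p {q} → Us n ++ p ⋖ʳ q → ∃ λ p′ → q ≡ Us n ++ p′ × p ⋖ʳ p′
⋖ʳ-Us-++ zero    p st           = _ , refl , st
⋖ʳ-Us-++ (suc n) p (there _ st) with ⋖ʳ-Us-++ n p st
... | p′ , refl , st′ = p′ , refl , st′

Us-++-D-split : ∀ j k A V → Us (suc k) ++ D ∷ A ≡ Us j ++ V →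
  (suc k ≡ j × V ≡ D ∷ A) ⊎ (∃ λ r → suc k ≡ j + suc r × V ≡ Us (suc r) ++ D ∷ A)
Us-++-D-split zero           k       A V e = inj₂ (k , refl , sym e)
Us-++-D-split (suc zero)     zero    A V e = inj₁ (refl , sym (∷-injectiveʳ e))
Us-++-D-split (suc (suc j))  zero    A V ()
Us-++-D-split (suc j)        (suc k) A V e with Us-++-D-split j k A V (∷-injectiveʳ e)
... | inj₁ (e₁ , e₂)     = inj₁ (cong suc e₁ , e₂)
... | inj₂ (r , e₁ , e₂) = inj₂ (r , cong suc e₁ , e₂)

Ds-⋖ʳ : ∀ n k A → Ds (suc n) ++ Us (suc k) ++ D ∷ A ⋖ʳ Ds (suc (suc n)) ++ Us (suc k) ++ A
Ds-⋖ʳ n k A = subst₂ _⋖ʳ_ (replicate-∷ D n _)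
  (trans (replicate-∷ D n _) (cong (D ∷_) (replicate-∷ D n _)))
  (⋖ʳ-prefix (Ds n) (here k A))

dyckFrom-Us-++ : ∀ n h p → dyckFrom h (Us n ++ p) ≡ dyckFrom (h + n) p
dyckFrom-Us-++ zero    h       p = cong (λ x → dyckFrom x p) (sym (+-identityʳ h))
dyckFrom-Us-++ (suc n) zero    p = dyckFrom-Us-++ n 1 p
dyckFrom-Us-++ (suc n) (suc h) p =
  trans (dyckFrom-Us-++ n (suc (suc h)) p) (cong (λ x → dyckFrom x p) (sym (+-suc (suc h) n)))

dyckFrom-+-Ds : ∀ h n a → dyckFrom (h + n) (Ds (n + a)) ≡ dyckFrom h (Ds a)
dyckFrom-+-Ds h zero    a = cong (λ x → dyckFrom x (Ds a)) (+-identityʳ h)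
dyckFrom-+-Ds h (suc n) a rewrite +-suc h n = dyckFrom-+-Ds h n a

dyckFrom-++-cong : ∀ xs {p q} → (∀ h → dyckFrom h p ≡ dyckFrom h q) →
  ∀ h → dyckFrom h (xs ++ p) ≡ dyckFrom h (xs ++ q)
dyckFrom-++-cong []       e h       = e h
dyckFrom-++-cong (U ∷ xs) e zero    = dyckFrom-++-cong xs e 1
dyckFrom-++-cong (U ∷ xs) e (suc h) = dyckFrom-++-cong xs e (suc (suc h))
dyckFrom-++-cong (D ∷ xs) e zero    = refl
dyckFrom-++-cong (D ∷ xs) e (suc h) = dyckFrom-++-cong xs e h

dyckFrom-++⁻ : ∀ xs p h → T (dyckFrom h (xs ++ p)) → ∃ λ h′ → T (dyckFrom h′ p)
dyckFrom-++⁻ []       p h       t = h , t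
dyckFrom-++⁻ (U ∷ xs) p zero    t = dyckFrom-++⁻ xs p 1 t
dyckFrom-++⁻ (U ∷ xs) p (suc h) t = dyckFrom-++⁻ xs p (suc (suc h)) t
dyckFrom-++⁻ (D ∷ xs) p (suc h) t = dyckFrom-++⁻ xs p h t

dyckFrom-Ds⇒≡ : ∀ h n → T (dyckFrom h (Ds n)) → h ≡ n
dyckFrom-Ds⇒≡ zero    zero    t = refl
dyckFrom-Ds⇒≡ (suc h) (suc n) t = cong suc (dyckFrom-Ds⇒≡ h n t)

upRunsAcc-Us-++ : ∀ n k p → upRunsAcc k (Us n ++ p) ≡ upRunsAcc (k + n) p
upRunsAcc-Us-++ zero    k       p = cong (λ x → upRunsAcc x p) (sym (+-identityʳ k))
upRunsAcc-Us-++ (suc n) zero    p = upRunsAcc-Us-++ n 1 p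
upRunsAcc-Us-++ (suc n) (suc k) p =
  trans (upRunsAcc-Us-++ n (suc (suc k)) p) (cong (λ x → upRunsAcc x p) (sym (+-suc (suc k) n)))

upRunsAcc-Ds-++ : ∀ n p → upRunsAcc 0 (Ds n ++ p) ≡ upRunsAcc 0 p
upRunsAcc-Ds-++ zero    p = refl
upRunsAcc-Ds-++ (suc n) p = upRunsAcc-Ds-++ n p

upRunsAcc-Ds : ∀ n → upRunsAcc 0 (Ds n) ≡ []
upRunsAcc-Ds n = trans (cong (upRunsAcc 0) (sym (++-identityʳ (Ds n)))) (upRunsAcc-Ds-++ n [])

upRunsAcc-suc-Ds : ∀ k n → upRunsAcc (suc k) (Ds n) ≡ suc k ∷ []
upRunsAcc-suc-Ds k zero    = refl
upRunsAcc-suc-Ds k (suc n) = cong (suc k ∷_) (upRunsAcc-Ds n)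

module _ (P : ℕ → Set) where

  All-upRunsAcc-++-cong : ∀ xs {p q} → (∀ k → All P (upRunsAcc k p) ⇔ All P (upRunsAcc k q)) →
    ∀ k → All P (upRunsAcc k (xs ++ p)) ⇔ All P (upRunsAcc k (xs ++ q))
  All-upRunsAcc-++-cong []       e k       = e k
  All-upRunsAcc-++-cong (U ∷ xs) e zero    = All-upRunsAcc-++-cong xs e 1
  All-upRunsAcc-++-cong (U ∷ xs) e (suc k) = All-upRunsAcc-++-cong xs e (suc (suc k))
  All-upRunsAcc-++-cong (D ∷ xs) e zero    = All-upRunsAcc-++-cong xs e zero
  All-upRunsAcc-++-cong (D ∷ xs) {p} {q} e (suc k) =
    mk⇔ (λ { (px ∷ r) → px ∷ Equivalence.to rest r })
    (λ { (px ∷ r) → px ∷ Equivalence.from rest r })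
    where
    rest : All P (upRunsAcc 0 (xs ++ p)) ⇔ All P (upRunsAcc 0 (xs ++ q))
    rest = All-upRunsAcc-++-cong xs e zero

  All-upRunsAcc-++-D⁻ : ∀ xs p k → All P (upRunsAcc k (xs ++ D ∷ p)) → All P (upRunsAcc 0 p)
  All-upRunsAcc-++-D⁻ []       p zero    r       = r
  All-upRunsAcc-++-D⁻ []       p (suc k) (_ ∷ r) = r
  All-upRunsAcc-++-D⁻ (U ∷ xs) p zero    r       = All-upRunsAcc-++-D⁻ xs p 1 r
  All-upRunsAcc-++-D⁻ (U ∷ xs) p (suc k) r       = All-upRunsAcc-++-D⁻ xs p (suc (suc k)) r
  All-upRunsAcc-++-D⁻ (D ∷ xs) p zero    r       = All-upRunsAcc-++-D⁻ xs p 0 r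
  All-upRunsAcc-++-D⁻ (D ∷ xs) p (suc k) (_ ∷ r) = All-upRunsAcc-++-D⁻ xs p 0 r

  All-upRunsAcc-reverse-++⁻ : ∀ xs → NoHeadU xs → ∀ p →
    All P (upRunsAcc 0 (reverse xs ++ p)) → All P (upRunsAcc 0 p)
  All-upRunsAcc-reverse-++⁻ []       _ p r = r
  All-upRunsAcc-reverse-++⁻ (D ∷ xs) _ p r = All-upRunsAcc-++-D⁻ (reverse xs) p 0
    (subst (λ q → All P (upRunsAcc 0 q))
           (trans (cong (_++ p) (unfold-reverse D xs)) (++-assoc (reverse xs) [ D ] p)) r)

+-shift : ∀ i y z w → (+ i ℤ.+ (+ y ℤ.- + z) ≡ + w) ⇔ (w + z ≡ y + i)
+-shift i y z w = mk⇔
  (λ e → ℤ.+-injective (begin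
    + (w + z)                            ≡⟨ ℤ.pos-+ w z ⟩
    + w ℤ.+ + z                          ≡⟨ cong (ℤ._+ + z) e ⟨
    + i ℤ.+ (+ y ℤ.- + z) ℤ.+ + z        ≡⟨ ring₁ (+ i) (+ y) (+ z) ⟩
    + y ℤ.+ + i                          ≡⟨ ℤ.pos-+ y i ⟨
    + (y + i)                            ∎))
  (λ e → begin
    + i ℤ.+ (+ y ℤ.- + z)                ≡⟨ ring₂ (+ i) (+ y) (+ z) ⟩
    (+ y ℤ.+ + i) ℤ.- + z                ≡⟨ cong (ℤ._- + z) (ℤ.pos-+ y i) ⟨
    + (y + i) ℤ.- + z                    ≡⟨ cong (λ x → + x ℤ.- + z) e ⟨
    + (w + z) ℤ.- + z                    ≡⟨ cong (ℤ._- + z) (ℤ.pos-+ w z) ⟩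
    (+ w ℤ.+ + z) ℤ.- + z                ≡⟨ ring₃ (+ w) (+ z) ⟩
    + w                                  ∎)
  where
  open ≡-Reasoning
  ring₁ : ∀ x y z → x ℤ.+ (y ℤ.- z) ℤ.+ z ≡ y ℤ.+ x
  ring₁ = solveℤ-∀
  ring₂ : ∀ x y z → x ℤ.+ (y ℤ.- z) ≡ (y ℤ.+ x) ℤ.- z
  ring₂ = solveℤ-∀
  ring₃ : ∀ x y → (x ℤ.+ y) ℤ.- y ≡ x
  ring₃ = solveℤ-∀

endFrom-++ : ∀ p xs ys → endFrom p (xs ++ ys) ≡ endFrom (endFrom p xs) ys
endFrom-++ p []       ys = refl
endFrom-++ p (x ∷ xs) ys = endFrom-++ (p ⊕ x) xs ys

StaysIn-++ : ∀ p xs ys → StaysIn p xs → StaysIn (endFrom p xs) ys → StaysIn p (xs ++ ys)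
StaysIn-++ p []       ys _          s₂ = s₂
StaysIn-++ p (x ∷ xs) ys (h , s₁)   s₂ = h , StaysIn-++ (p ⊕ x) xs ys s₁ s₂

StaysIn-++⁻ˡ : ∀ p xs ys → StaysIn p (xs ++ ys) → StaysIn p xs
StaysIn-++⁻ˡ p []       ys _       = tt
StaysIn-++⁻ˡ p (x ∷ xs) ys (h , s) = h , StaysIn-++⁻ˡ (p ⊕ x) xs ys s

StaysIn-endFrom : ∀ {p} ss → 0ℤ ℤ.≤ proj₁ p → 0ℤ ℤ.≤ proj₂ p → StaysIn p ss →
  0ℤ ℤ.≤ proj₁ (endFrom p ss) × 0ℤ ℤ.≤ proj₂ (endFrom p ss)
StaysIn-endFrom []       0≤x 0≤y _               = 0≤x , 0≤y
StaysIn-endFrom (s ∷ ss) _   _   ((0≤x , 0≤y) , st) = StaysIn-endFrom ss 0≤x 0≤y st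

negate : Point → Point
negate (x , y) = (ℤ.- x , ℤ.- y)

⊕-negate : ∀ p → p ⊕ negate p ≡ origin
⊕-negate (x , y) = cong₂ _,_ (ℤ.+-inverseʳ x) (ℤ.+-inverseʳ y)

⊕≡origin⇒negate : ∀ p s → p ⊕ s ≡ origin → negate p ≡ s
⊕≡origin⇒negate (x , y) (dx , dy) e = cong₂ _,_ (inverse x dx (cong proj₁ e)) (inverse y dy (cong proj₂ e))
  where
  inverse : ∀ a b → a ℤ.+ b ≡ 0ℤ → ℤ.- a ≡ b
  inverse a b e = sym (trans (ring a b) (trans (cong (ℤ._- a) e) (ℤ.+-identityˡ (ℤ.- a))))
    where
    ring : ∀ a b → b ≡ (a ℤ.+ b) ℤ.- a
    ring = solveℤ-∀

dropLast : ∀ {A : Set} → List A → List A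
dropLast []           = []
dropLast (x ∷ [])     = []
dropLast (x ∷ y ∷ xs) = x ∷ dropLast (y ∷ xs)

dropLast-∷ʳ : ∀ {A : Set} (xs : List A) x → dropLast (xs ∷ʳ x) ≡ xs
dropLast-∷ʳ []           x = refl
dropLast-∷ʳ (y ∷ [])     x = refl
dropLast-∷ʳ (y ∷ z ∷ xs) x = cong (y ∷_) (dropLast-∷ʳ (z ∷ xs) x)

module _ {A B K L : Set} {keyA : A → K} {keyB : B → L} where

  keyedInverse : (f : A → B) (g : B → A) →
    (∀ {x y} → keyA x ≡ keyA y → keyB (f x) ≡ keyB (f y)) →
    (∀ {x y} → keyB x ≡ keyB y → keyA (g x) ≡ keyA (g y)) →
    (∀ y → keyB (f (g y)) ≡ keyB y) → (∀ x → keyA (g (f x)) ≡ keyA x) →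
    Inverse (On.setoid (setoid K) keyA) (On.setoid (setoid L) keyB)
  keyedInverse f g f-cong g-cong fg gf = record
    { to        = f
    ; from      = g
    ; to-cong   = f-cong
    ; from-cong = g-cong
    ; inverse   = (λ {y} x≈gy → trans (f-cong x≈gy) (fg y)) , (λ {x} y≈fx → trans (g-cong y≈fx) (gf x))
    }

module _ (m′ : ℕ) where

  m : ℕ
  m = suc m′

  -- Reversed back, attach a c S is reverse S ++ D^c U^m D^(m+a): the path reverse S ++ D^(c+a), one block
  -- of m up steps smaller, with a peak U^m D^m inserted into its final descent at height a.
  attach : ℕ → ℕ → Path → Path
  attach a c S = Ds (m + a) ++ Us m ++ Ds c ++ S

  reduct : ℕ → ℕ → Path → Path
  reduct a c S = Ds (a + c) ++ S

  attach-injective : ∀ {a c S a′ c′ S′} → NoHeadD S → NoHeadD S′ →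
    attach a c S ≡ attach a′ c′ S′ → a ≡ a′ × c ≡ c′ × S ≡ S′
  attach-injective {a} {a′ = a′} h h′ e with Ds-++-injective tt tt e
  ... | e₁ , e₂ with Ds-++-injective h h′ (++-cancelˡ (Us m) _ _ e₂)
  ... | e₃ , e₄ = +-cancelˡ-≡ m a a′ e₁ , e₃ , e₄

  attach-⋖ʳ-tail : ∀ a c {S S′} → S ⋖ʳ S′ → attach a c S ⋖ʳ attach a c S′
  attach-⋖ʳ-tail a c st = ⋖ʳ-prefix (Ds (m + a)) (⋖ʳ-prefix (Us m) (⋖ʳ-prefix (Ds c) st))

  attach-⋖ʳ-shift : ∀ a c S → attach a (suc c) S ⋖ʳ attach (suc a) c S
  attach-⋖ʳ-shift a c S = subst (λ n → attach a (suc c) S ⋖ʳ Ds n ++ Us m ++ Ds c ++ S)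
    (cong suc (sym (+-suc m′ a))) (Ds-⋖ʳ (m′ + a) m′ (Ds c ++ S))

  attach-⋖ʳ-inner : ∀ a c k A →
    attach a (suc c) (Us (suc k) ++ D ∷ A) ⋖ʳ attach a (suc (suc c)) (Us (suc k) ++ A)
  attach-⋖ʳ-inner a c k A = subst₂ _⋖ʳ_ (assoc (D ∷ Ds c ++ Us (suc k) ++ D ∷ A))
    (assoc (D ∷ D ∷ Ds c ++ Us (suc k) ++ A)) (⋖ʳ-prefix (Ds (m + a) ++ Us m) (Ds-⋖ʳ c k A))
    where
    assoc : ∀ xs → (Ds (m + a) ++ Us m) ++ xs ≡ Ds (m + a) ++ Us m ++ xs
    assoc = ++-assoc (Ds (m + a)) (Us m)

  attach-⋖ʳ-merge : ∀ a k A → attach a 0 (Us (suc k) ++ D ∷ A) ⋖ʳ attach (suc a) 0 (Us (suc k) ++ A)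
  attach-⋖ʳ-merge a k A = subst₂ (λ s t → Ds (m + a) ++ s ⋖ʳ Ds t ++ Us m ++ Us (suc k) ++ A)
    (replicate-+-++ U m (suc k) _) (cong suc (sym (+-suc m′ a)))
    (subst (λ t → Ds (m + a) ++ Us (m + suc k) ++ D ∷ A ⋖ʳ Ds (suc (suc (m′ + a))) ++ t)
      (replicate-+-++ U m (suc k) A) (Ds-⋖ʳ (m′ + a) (m′ + suc k) A))

  attach-≤ʳ-shift : ∀ d a c S → attach a (d + c) S ≤ʳ attach (a + d) c S
  attach-≤ʳ-shift zero    a c S = subst (λ x → attach a c S ≤ʳ attach x c S) (sym (+-identityʳ a)) ε
  attach-≤ʳ-shift (suc d) a c S = attach-⋖ʳ-shift a (d + c) S
    ◅ subst (λ x → attach (suc a) (d + c) S ≤ʳ attach x c S) (sym (+-suc a d))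
            (attach-≤ʳ-shift d (suc a) c S)

  attach-≤ʳ⁺ : ∀ {a c S a′ c′ T} → NoHeadD S → NoHeadD T → reduct a c S ≤ʳ reduct a′ c′ T →
    a ≤ a′ → (c ≡ 0 → c′ ≡ 0) → attach a c S ≤ʳ attach a′ c′ T
  attach-≤ʳ⁺ {a} {c} {S} {a′} {c′} {T} h h′ le = go le a c S refl h refl
    where
    go : ∀ {s t} → s ≤ʳ t → ∀ a c S → s ≡ reduct a c S → NoHeadD S → t ≡ reduct a′ c′ T →
         a ≤ a′ → (c ≡ 0 → c′ ≡ 0) → attach a c S ≤ʳ attach a′ c′ T
    go ε a c S refl h e a≤a′ c≡0⇒ with Ds-++-injective h h′ e
    ... | a+c≡a′+c′ , refl with m≤n⇒∃[o]m+o≡n a≤a′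
    ... | d , refl =
      subst (λ x → attach a x S ≤ʳ attach (a + d) c′ S) (sym c≡d+c′) (attach-≤ʳ-shift d a c′ S)
      where
      c≡d+c′ : c ≡ d + c′
      c≡d+c′ = +-cancelˡ-≡ a c (d + c′) (trans a+c≡a′+c′ (+-assoc a d c′))
    go (st ◅ sts) a c S refl h e a≤a′ c≡0⇒ with ⋖ʳ-Ds-++ (a + c) S h st
    ... | inj₂ (S₁ , refl , st₁) =
      attach-⋖ʳ-tail a c st₁ ◅ go sts a c S₁ refl (⋖ʳ-NoHeadD st₁ h) e a≤a′ c≡0⇒
    go (st ◅ sts) a zero S refl h e a≤a′ c≡0⇒ | inj₁ (n , k , A , a+0≡1+n , refl , refl) =
      attach-⋖ʳ-merge a k A ◅ go sts (suc a) 0 (Us (suc k) ++ A)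
        (cong (λ x → Ds (suc x) ++ Us (suc k) ++ A) (sym a+0≡1+n)) tt e 1+a≤a′ (λ _ → c≡0⇒ refl)
      where
      open ≤-Reasoning
      1+a≤a′ : suc a ≤ a′
      1+a≤a′ = begin
        suc a                                          ≡⟨ cong suc (trans (sym (+-identityʳ a)) a+0≡1+n) ⟩
        suc (suc n)                                    ≡⟨ leadingD-Ds-++ (suc (suc n)) tt ⟨
        leadingD (Ds (suc (suc n)) ++ Us (suc k) ++ A) ≤⟨ ≤ʳ-leadingD-mono sts ⟩
        leadingD _                                     ≡⟨ cong leadingD e ⟩
        leadingD (reduct a′ c′ T)                      ≡⟨ leadingD-Ds-++ (a′ + c′) h′ ⟩
        a′ + c′                                        ≡⟨ cong (λ x → a′ + x) (c≡0⇒ refl) ⟩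
        a′ + 0                                         ≡⟨ +-identityʳ a′ ⟩
        a′                                             ∎
    go (st ◅ sts) a (suc c) S refl h e a≤a′ c≡0⇒ | inj₁ (n , k , A , a+1+c≡1+n , refl , refl) =
      attach-⋖ʳ-inner a c k A ◅ go sts a (suc (suc c)) (Us (suc k) ++ A)
        (cong (λ x → Ds x ++ Us (suc k) ++ A) (trans (cong suc (sym a+1+c≡1+n)) (sym (+-suc a (suc c)))))
        tt e a≤a′ (λ ())

  AttachedAbove : ℕ → ℕ → Path → Path → Set
  AttachedAbove a c S q = ∃₂ λ a₁ c₁ → ∃ λ S₁ → NoHeadD S₁ × q ≡ attach a₁ c₁ S₁ ×
    reduct a c S ≤ʳ reduct a₁ c₁ S₁ × a ≤ a₁ × (c ≡ 0 → c₁ ≡ 0)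

  -- Without 1 ≤ a + c, merging the peak into an up-run of S has no counterpart move on the reduct.
  attach-⋖ʳ⁻ : ∀ a c {S q} → NoHeadD S → 1 ≤ a + c → attach a c S ⋖ʳ q → AttachedAbove a c S q
  attach-⋖ʳ⁻ a c {S} h pos st with ⋖ʳ-Ds-++ (m + a) (Us m ++ Ds c ++ S) tt st
  ... | inj₁ (n , k , A , m+a≡1+n , e , refl) with Us-++-D-split m k A (Ds c ++ S) (sym e)
  attach-⋖ʳ⁻ a zero    h pos st | inj₁ _ | inj₁ (_ , refl) = ⊥-elim h
  attach-⋖ʳ⁻ a (suc c) {S} h pos st | inj₁ (n , _ , _ , m+a≡1+n , _ , refl) | inj₁ (refl , e′)
    with ∷-injectiveʳ e′
  ... | refl = suc a , c , S , h , cong (λ x → Ds x ++ Us m ++ Ds c ++ S) 2+n≡m+1+a ,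
               subst (λ x → reduct a (suc c) S ≤ʳ Ds x ++ S) (+-suc a c) ε , n≤1+n a , (λ ())
    where
    2+n≡m+1+a : suc (suc n) ≡ m + suc a
    2+n≡m+1+a = trans (cong suc (sym m+a≡1+n)) (sym (+-suc m a))
  attach-⋖ʳ⁻ a (suc c) h pos st | inj₁ _ | inj₂ (_ , _ , ())
  attach-⋖ʳ⁻ zero zero h () st | inj₁ _ | inj₂ _
  attach-⋖ʳ⁻ (suc a) zero h pos st | inj₁ (n , k , A , m+a≡1+n , _ , refl) | inj₂ (r , 1+k≡m+1+r , refl) =
    suc (suc a) , 0 , Us (suc r) ++ A , tt , cong₂ _++_ (cong Ds 2+n≡m+2+a) Us-split ,
    Ds-⋖ʳ (a + 0) r A ◅ ε , n≤1+n (suc a) , (λ _ → refl)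
    where
    2+n≡m+2+a : suc (suc n) ≡ m + suc (suc a)
    2+n≡m+2+a = trans (cong suc (sym m+a≡1+n)) (sym (+-suc m (suc a)))
    Us-split : Us (suc k) ++ A ≡ Us m ++ Us (suc r) ++ A
    Us-split = trans (cong (λ x → Us x ++ A) 1+k≡m+1+r) (replicate-+-++ U m (suc r) A)
  attach-⋖ʳ⁻ a c {S} h pos st | inj₂ (_ , refl , st₁) with ⋖ʳ-Us-++ m (Ds c ++ S) st₁
  ... | _ , refl , st₂ with ⋖ʳ-Ds-++ c S h st₂
  ... | inj₁ (c′ , k , A , refl , refl , refl) =
    a , suc (suc c′) , Us (suc k) ++ A , tt , refl , reduct-step ◅ ε , ≤-refl , (λ ())
    where
    reduct-step : reduct a (suc c′) (Us (suc k) ++ D ∷ A) ⋖ʳ reduct a (suc (suc c′)) (Us (suc k) ++ A)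
    reduct-step = subst₂ (λ x y → Ds x ++ Us (suc k) ++ D ∷ A ⋖ʳ Ds y ++ Us (suc k) ++ A)
      (sym (+-suc a c′)) (trans (cong suc (sym (+-suc a c′))) (sym (+-suc a (suc c′))))
      (Ds-⋖ʳ (a + c′) k A)
  ... | inj₂ (S′ , refl , st₃) =
    a , c , S′ , ⋖ʳ-NoHeadD st₃ h , refl , ⋖ʳ-prefix (Ds (a + c)) st₃ ◅ ε , ≤-refl , (λ e → e)

  attach-≤ʳ⁻ : ∀ {a c S a′ c′ T} → NoHeadD S → NoHeadD T → 1 ≤ a + c →
    attach a c S ≤ʳ attach a′ c′ T →
    reduct a c S ≤ʳ reduct a′ c′ T × a ≤ a′ × (c ≡ 0 → c′ ≡ 0)
  attach-≤ʳ⁻ {a} {c} {S} {a′} {c′} {T} h h′ pos le = go le a c S refl h pos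
    where
    go : ∀ {s} → s ≤ʳ attach a′ c′ T → ∀ a c S → s ≡ attach a c S → NoHeadD S → 1 ≤ a + c →
         reduct a c S ≤ʳ reduct a′ c′ T × a ≤ a′ × (c ≡ 0 → c′ ≡ 0)
    go ε a c S e h pos with attach-injective h′ h e
    ... | refl , refl , refl = ε , ≤-refl , (λ e → e)
    go (st ◅ sts) a c S refl h pos with attach-⋖ʳ⁻ a c h pos st
    ... | a₁ , c₁ , S₁ , h₁ , refl , le₁ , a≤a₁ , c≡0⇒c₁≡0
      with go sts a₁ c₁ S₁ refl h₁ (≤-trans pos (Ds-++-≤ʳ⇒≤ h h₁ le₁))
    ... | le₂ , a₁≤a′ , c₁≡0⇒c′≡0 = le₁ ◅◅ le₂ , ≤-trans a≤a₁ a₁≤a′ , (λ e → c₁≡0⇒c′≡0 (c≡0⇒c₁≡0 e))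

  IsDMNʳ : ℕ → Path → Set
  IsDMNʳ k r = IsDyck (m * k) (reverse r) × All (m ∣_) (upRuns (reverse r))

  reverse-attach : ∀ a c S → reverse (attach a c S) ≡ reverse S ++ Ds c ++ Us m ++ Ds (m + a)
  reverse-attach a c S = begin
    reverse (attach a c S)
      ≡⟨ reverse-replicate-++ D (m + a) _ ⟩
    reverse (Us m ++ Ds c ++ S) ++ Ds (m + a)
      ≡⟨ cong (_++ Ds (m + a)) (reverse-replicate-++ U m _) ⟩
    (reverse (Ds c ++ S) ++ Us m) ++ Ds (m + a)
      ≡⟨ cong (λ x → (x ++ Us m) ++ Ds (m + a)) (reverse-replicate-++ D c S) ⟩
    ((reverse S ++ Ds c) ++ Us m) ++ Ds (m + a)
      ≡⟨ ++-assoc (reverse S ++ Ds c) _ _ ⟩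
    (reverse S ++ Ds c) ++ Us m ++ Ds (m + a)
      ≡⟨ ++-assoc (reverse S) _ _ ⟩
    reverse S ++ Ds c ++ Us m ++ Ds (m + a) ∎
    where open ≡-Reasoning

  reverse-reduct : ∀ a c S → reverse (reduct a c S) ≡ reverse S ++ Ds (c + a)
  reverse-reduct a c S = trans (reverse-replicate-++ D (a + c) S) (cong (λ x → reverse S ++ Ds x) (+-comm a c))

  peak-dyckFrom : ∀ a c h → dyckFrom h (Ds c ++ Us m ++ Ds (m + a)) ≡ dyckFrom h (Ds (c + a))
  peak-dyckFrom a zero    h       = trans (dyckFrom-Us-++ m h _) (dyckFrom-+-Ds h m a)
  peak-dyckFrom a (suc c) zero    = refl
  peak-dyckFrom a (suc c) (suc h) = peak-dyckFrom a c h

  peak-upRunsAcc : ∀ k a → upRunsAcc k (Us m ++ Ds (m + a)) ≡ k + m ∷ []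
  peak-upRunsAcc k a = begin
    upRunsAcc k (Us m ++ Ds (m + a))       ≡⟨ upRunsAcc-Us-++ m k _ ⟩
    upRunsAcc (k + m) (Ds (m + a))         ≡⟨ cong (λ x → upRunsAcc x (Ds (m + a))) (+-suc k m′) ⟩
    upRunsAcc (suc (k + m′)) (Ds (m + a))  ≡⟨ upRunsAcc-suc-Ds (k + m′) (m + a) ⟩
    suc (k + m′) ∷ []                      ≡⟨ cong (_∷ []) (+-suc k m′) ⟨
    k + m ∷ []                             ∎
    where open ≡-Reasoning

  -- The peak's U^m is a run of its own when c > 0 and lengthens the preceding run by m when c = 0.
  peak-upRuns : ∀ a c k →
    All (m ∣_) (upRunsAcc k (Ds c ++ Us m ++ Ds (m + a))) ⇔ All (m ∣_) (upRunsAcc k (Ds (c + a)))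
  peak-upRuns a zero zero rewrite peak-upRunsAcc 0 a | upRunsAcc-Ds a =
    mk⇔ (λ _ → []) (λ _ → ∣-refl ∷ [])
  peak-upRuns a zero (suc k) rewrite peak-upRunsAcc (suc k) a | upRunsAcc-suc-Ds k a =
    mk⇔ (λ { (m∣k+m ∷ []) → ∣m+n∣m⇒∣n (subst (m ∣_) (+-comm (suc k) m) m∣k+m) ∣-refl ∷ [] })
        (λ { (m∣k ∷ []) → ∣m∣n⇒∣m+n m∣k ∣-refl ∷ [] })
  peak-upRuns a (suc c) zero
    rewrite upRunsAcc-Ds-++ c (Us m ++ Ds (m + a)) | peak-upRunsAcc 0 a | upRunsAcc-Ds (c + a) =
    mk⇔ (λ _ → []) (λ _ → ∣-refl ∷ [])
  peak-upRuns a (suc c) (suc k)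
    rewrite upRunsAcc-Ds-++ c (Us m ++ Ds (m + a)) | peak-upRunsAcc 0 a | upRunsAcc-Ds (c + a) =
    mk⇔ (λ { (m∣k ∷ _) → m∣k ∷ [] }) (λ { (m∣k ∷ _) → m∣k ∷ ∣-refl ∷ [] })

  length-reverse-attach : ∀ a c S → length (reverse (attach a c S)) ≡ m + m + length (reverse (reduct a c S))
  length-reverse-attach a c S = begin
    length (reverse (attach a c S))           ≡⟨ length-reverse (attach a c S) ⟩
    length (attach a c S)                     ≡⟨ length-replicate-++ D (m + a) _ ⟩
    m + a + length (Us m ++ Ds c ++ S)        ≡⟨ cong (λ x → m + a + x) (length-replicate-++ U m _) ⟩
    m + a + (m + length (Ds c ++ S))          ≡⟨ cong (λ x → m + a + (m + x)) (length-replicate-++ D c S) ⟩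
    m + a + (m + (c + length S))              ≡⟨ rearrange m a c (length S) ⟩
    m + m + (a + c + length S)                ≡⟨ cong (λ x → m + m + x) (length-replicate-++ D (a + c) S) ⟨
    m + m + length (reduct a c S)             ≡⟨ cong (λ x → m + m + x) (length-reverse (reduct a c S)) ⟨
    m + m + length (reverse (reduct a c S))   ∎
    where
    open ≡-Reasoning
    rearrange : ∀ m a c l → m + a + (m + (c + l)) ≡ m + m + (a + c + l)
    rearrange = solve-∀

  attach-IsDMNʳ : ∀ k a c S → IsDMNʳ k (reduct a c S) ⇔ IsDMNʳ (suc k) (attach a c S)
  attach-IsDMNʳ k a c S = mk⇔
    (λ ((l , d) , r) →
      (trans (length-reverse-attach a c S) (trans (cong (λ x → m + m + x) l) (sym (size-suc m k))) ,
       subst T (sym dyck) d) , Equivalence.from runs r)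
    (λ ((l , d) , r) →
      (+-cancelˡ-≡ (m + m) _ _ (trans (sym (length-reverse-attach a c S)) (trans l (size-suc m k))) ,
       subst T dyck d) , Equivalence.to runs r)
    where
    size-suc : ∀ m k → 2 * (m * suc k) ≡ m + m + 2 * (m * k)
    size-suc = solve-∀
    dyck : dyckFrom 0 (reverse (attach a c S)) ≡ dyckFrom 0 (reverse (reduct a c S))
    dyck rewrite reverse-attach a c S | reverse-reduct a c S = dyckFrom-++-cong (reverse S) (peak-dyckFrom a c) 0
    runs : All (m ∣_) (upRuns (reverse (attach a c S))) ⇔ All (m ∣_) (upRuns (reverse (reduct a c S)))
    runs rewrite reverse-attach a c S | reverse-reduct a c S =
      All-upRunsAcc-++-cong (m ∣_) (reverse S) (peak-upRuns a c) 0

  Attached : Path → Set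
  Attached r = ∃₂ λ a c → ∃ λ S → NoHeadD S × r ≡ attach a c S

  -- The last up-run U^u of a path in 𝔻_{m,k+1} is followed by its final descent D^f; u ≤ f since the path
  -- ends on the axis, and m ∣ u.
  IsDMNʳ-Ds-Us-attached : ∀ k f u T₀ → NoHeadU T₀ → IsDMNʳ (suc k) (Ds f ++ Us (suc u) ++ T₀) →
    Attached (Ds f ++ Us (suc u) ++ T₀)
  IsDMNʳ-Ds-Us-attached k f u T₀ h ((_ , d) , r) =
    split (m≤n⇒∃[o]m+o≡n m≤1+u) (m≤n⇒∃[o]m+o≡n (≤-trans m≤1+u 1+u≤f))
    where
    reversed : reverse (Ds f ++ Us (suc u) ++ T₀) ≡ reverse T₀ ++ Us (suc u) ++ Ds f
    reversed = trans (reverse-replicate-++ D f _)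
      (trans (cong (_++ Ds f) (reverse-replicate-++ U (suc u) T₀)) (++-assoc (reverse T₀) _ _))
    1+u≤f : suc u ≤ f
    1+u≤f with dyckFrom-++⁻ (reverse T₀) (Us (suc u) ++ Ds f) 0 (subst (λ q → T (dyckFrom 0 q)) reversed d)
    ... | h′ , t = subst (suc u ≤_)
      (dyckFrom-Ds⇒≡ (h′ + suc u) f (subst T (dyckFrom-Us-++ (suc u) h′ (Ds f)) t)) (m≤n+m (suc u) h′)
    m≤1+u : m ≤ suc u
    m≤1+u with subst (All (m ∣_)) (trans (upRunsAcc-Us-++ (suc u) 0 (Ds f)) (upRunsAcc-suc-Ds u f))
                 (All-upRunsAcc-reverse-++⁻ (m ∣_) T₀ h _ (subst (λ q → All (m ∣_) (upRuns q)) reversed r))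
    ... | m∣1+u ∷ [] = ∣⇒≤ m∣1+u
    split : (∃ λ e → m + e ≡ suc u) → (∃ λ a → m + a ≡ f) → Attached (Ds f ++ Us (suc u) ++ T₀)
    split (zero , m+0≡1+u) (a , refl) = a , leadingD T₀ , dropD T₀ , dropD-NoHeadD T₀ ,
      cong₂ (λ x y → Ds (m + a) ++ Us x ++ y) (trans (sym m+0≡1+u) (+-identityʳ m)) (Ds-leadingD-dropD T₀)
    split (suc e , m+1+e≡1+u) (a , refl) = a , 0 , Us (suc e) ++ T₀ , tt ,
      trans (cong (λ x → Ds (m + a) ++ Us x ++ T₀) (sym m+1+e≡1+u))
            (cong (Ds (m + a) ++_) (replicate-+-++ U m (suc e) T₀))

  IsDMNʳ⇒Attached : ∀ k r → IsDMNʳ (suc k) r → Attached r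
  IsDMNʳ⇒Attached k r dm =
    subst Attached (sym r≡) (split (leadingD r) (dropD r) (dropD-NoHeadD r) (subst (IsDMNʳ (suc k)) r≡ dm))
    where
    r≡ : r ≡ Ds (leadingD r) ++ dropD r
    r≡ = Ds-leadingD-dropD r
    split : ∀ f p → NoHeadD p → IsDMNʳ (suc k) (Ds f ++ p) → Attached (Ds f ++ p)
    split zero    []      _ ((() , _) , _)
    split (suc f) []      _ ((_ , d) , _) =
      ⊥-elim (subst (λ q → T (dyckFrom 0 q)) (reverse-replicate-++ D (suc f) []) d)
    split f       (U ∷ p) _ dm′ = subst Attached (sym p≡)
      (IsDMNʳ-Ds-Us-attached k f (leadingU p) (dropU p) (dropU-NoHeadU p) (subst (IsDMNʳ (suc k)) p≡ dm′))
      where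
      p≡ : Ds f ++ U ∷ p ≡ Ds f ++ Us (suc (leadingU p)) ++ dropU p
      p≡ = cong (λ q → Ds f ++ U ∷ q) (Us-leadingU-dropU p)

  IsDMNʳ-leadingD : ∀ k r → IsDMNʳ (suc k) r → m ≤ leadingD r
  IsDMNʳ-leadingD k r dm with IsDMNʳ⇒Attached k r dm
  ... | a , _ , _ , _ , refl = subst (m ≤_) (sym (leadingD-Ds-++ (m + a) tt)) (m≤m+n m a)

  IsDMNʳ-0 : ∀ r → IsDMNʳ 0 r → r ≡ []
  IsDMNʳ-0 []      _ = refl
  IsDMNʳ-0 (b ∷ r) ((l , _) , _) with trans (sym (length-reverse (b ∷ r))) (trans l (cong (2 *_) (*-zeroʳ m)))
  ... | ()

  base : Path
  base = attach 0 0 []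

  IsDMNʳ-1 : ∀ r → IsDMNʳ 1 r → r ≡ base
  IsDMNʳ-1 r dm with IsDMNʳ⇒Attached 0 r dm
  ... | a , c , S , _ , refl with IsDMNʳ-0 (reduct a c S) (Equivalence.from (attach-IsDMNʳ 0 a c S) dm)
  IsDMNʳ-1 _ _ | zero , zero , .[] , _ , refl | refl = refl

  base-IsDMNʳ : IsDMNʳ 1 base
  base-IsDMNʳ = Equivalence.to (attach-IsDMNʳ 0 0 0 []) ((cong (2 *_) (sym (*-zeroʳ m)) , tt) , [])

  step : ℕ → ℕ → Point
  step c d = (+ m ℤ.- + c , + c ℤ.- + d)

  lowerDepth upperDepth : Point → ℕ
  lowerDepth (dx , dy) = ℤ.∣ + m ℤ.- dx ∣
  upperDepth (dx , dy) = ℤ.∣ + m ℤ.- (dx ℤ.+ dy) ∣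

  lowerDepth-step : ∀ c d → lowerDepth (step c d) ≡ c
  lowerDepth-step c d = cong ℤ.∣_∣ (ring (+ m) (+ c))
    where
    ring : ∀ x y → x ℤ.- (x ℤ.- y) ≡ y
    ring = solveℤ-∀

  upperDepth-step : ∀ c d → upperDepth (step c d) ≡ d
  upperDepth-step c d = cong ℤ.∣_∣ (ring (+ m) (+ c) (+ d))
    where
    ring : ∀ x y z → x ℤ.- ((x ℤ.- y) ℤ.+ (y ℤ.- z)) ≡ z
    ring = solveℤ-∀

  step-InS : ∀ c d → (c ≡ 0 → d ≡ 0) → InS m (step c d)
  step-InS zero d d≡0 rewrite d≡0 refl = inj₁ (ℤ.+-identityʳ (+ m) , refl)
  step-InS (suc c) d _ =
    inj₂ (dx<m , subst (ℤ._≤ + m) (sym (ring (+ m) (+ suc c) (+ d))) (ℤ.i-j≤i (+ m) (+ d)))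
    where
    ring : ∀ x y z → (x ℤ.- y) ℤ.+ (y ℤ.- z) ≡ x ℤ.- z
    ring = solveℤ-∀
    dx<m : + m ℤ.- + suc c ℤ.< + m
    dx<m = subst (+ m ℤ.- + suc c ℤ.<_) (ℤ.+-identityʳ (+ m)) (ℤ.+-monoʳ-< (+ m) (ℤ.-<+ {c} {0}))

  InS-depths-nonneg : ∀ {s} → InS m s →
    0ℤ ℤ.≤ + m ℤ.- proj₁ s × 0ℤ ℤ.≤ + m ℤ.- (proj₁ s ℤ.+ proj₂ s)
  InS-depths-nonneg (inj₁ (refl , refl)) =
    ℤ.≤-reflexive (sym (ring (+ m))) , ℤ.≤-reflexive (sym (ring′ (+ m)))
    where
    ring : ∀ x → x ℤ.- x ≡ 0ℤ
    ring = solveℤ-∀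
    ring′ : ∀ x → x ℤ.- (x ℤ.+ 0ℤ) ≡ 0ℤ
    ring′ = solveℤ-∀
  InS-depths-nonneg (inj₂ (dx<m , dx+dy≤m)) = ℤ.i≤j⇒0≤j-i (ℤ.<⇒≤ dx<m) , ℤ.i≤j⇒0≤j-i dx+dy≤m

  InS⇒step : ∀ {s} → InS m s → s ≡ step (lowerDepth s) (upperDepth s)
  InS⇒step {dx , dy} ins with InS-depths-nonneg ins
  ... | 0≤m-dx , 0≤m-dx-dy = cong₂ _,_
    (trans (sym (ring (+ m) dx)) (cong (λ x → + m ℤ.- x) (sym (ℤ.0≤i⇒+∣i∣≡i 0≤m-dx))))
    (trans (sym (ring′ (+ m) dx dy))
           (cong₂ ℤ._-_ (sym (ℤ.0≤i⇒+∣i∣≡i 0≤m-dx)) (sym (ℤ.0≤i⇒+∣i∣≡i 0≤m-dx-dy))))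
    where
    ring : ∀ x y → x ℤ.- (x ℤ.- y) ≡ y
    ring = solveℤ-∀
    ring′ : ∀ x y z → (x ℤ.- y) ℤ.- (x ℤ.- (y ℤ.+ z)) ≡ z
    ring′ = solveℤ-∀

  InS-depths : ∀ {s} → InS m s → lowerDepth s ≡ 0 → upperDepth s ≡ 0
  InS-depths (inj₁ (refl , refl)) _ = cong ℤ.∣_∣ (ring (+ m))
    where
    ring : ∀ x → x ℤ.- (x ℤ.+ 0ℤ) ≡ 0ℤ
    ring = solveℤ-∀
  InS-depths {dx , _} (inj₂ (dx<m , _)) e = ⊥-elim (ℤ.<-irrefl (sym m≡dx) dx<m)
    where
    m≡dx : + m ≡ dx
    m≡dx = ℤ.i-j≡0⇒i≡j (+ m) dx (ℤ.∣i∣≡0⇒i≡0 e)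

  ⊕-step : ∀ i j c d i′ j′ →
    ((+ i , + j) ⊕ step c d ≡ (+ i′ , + j′)) ⇔ (i′ + c ≡ m + i × j′ + d ≡ c + j)
  ⊕-step i j c d i′ j′ = mk⇔
    (λ e → to (+-shift i m c i′) (cong proj₁ e) , to (+-shift j c d j′) (cong proj₂ e))
    (λ (e₁ , e₂) → cong₂ _,_ (from (+-shift i m c i′) e₁) (from (+-shift j c d j′) e₂))
    where open Equivalence

  depthAndTailFrom : ℕ → Path → ℕ × Path
  depthAndTailFrom zero    p = leadingD p , dropD p
  depthAndTailFrom (suc e) p = 0 , Us (suc e) ++ p

  -- For r = attach a c S these recover (c , S) and the reduct; on other paths they return junk.
  depthAndTail : Path → ℕ × Path
  depthAndTail r = depthAndTailFrom (leadingU (dropD r) ∸ m) (dropU (dropD r))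

  depth : Path → ℕ
  depth r = proj₁ (depthAndTail r)

  detach : Path → Path
  detach r = Ds ((leadingD r ∸ m) + depth r) ++ proj₂ (depthAndTail r)

  depthAndTail-attach : ∀ a c S → NoHeadD S → depthAndTail (attach a c S) ≡ (c , S)
  depthAndTail-attach a c S h = trans (cong₂ depthAndTailFrom run rest) (afterPeak c S h)
    where
    afterPeak : ∀ c S → NoHeadD S → depthAndTailFrom (leadingU (Ds c ++ S)) (dropU (Ds c ++ S)) ≡ (c , S)
    afterPeak (suc c) S h       = cong₂ _,_ (leadingD-Ds-++ (suc c) h) (dropD-Ds-++ (suc c) h)
    afterPeak zero    []      h = refl
    afterPeak zero    (U ∷ S) h = cong (0 ,_) (sym (Us-leadingU-dropU (U ∷ S)))
    run : leadingU (dropD (attach a c S)) ∸ m ≡ leadingU (Ds c ++ S)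
    run = trans (cong (λ p → leadingU p ∸ m) (dropD-Ds-++ (m + a) {Us m ++ Ds c ++ S} tt))
            (trans (cong (_∸ m) (leadingU-Us-++ m (Ds c ++ S))) (m+n∸m≡n m _))
    rest : dropU (dropD (attach a c S)) ≡ dropU (Ds c ++ S)
    rest = trans (cong dropU (dropD-Ds-++ (m + a) {Us m ++ Ds c ++ S} tt)) (dropU-Us-++ m (Ds c ++ S))

  detach-attach : ∀ a c S → NoHeadD S → detach (attach a c S) ≡ reduct a c S
  detach-attach a c S h = begin
    detach (attach a c S)
      ≡⟨ cong₂ (λ x y → Ds ((x ∸ m) + proj₁ y) ++ proj₂ y)
               (leadingD-Ds-++ (m + a) tt) (depthAndTail-attach a c S h) ⟩
    Ds ((m + a ∸ m) + c) ++ S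
      ≡⟨ cong (λ x → Ds (x + c) ++ S) (m+n∸m≡n m a) ⟩
    reduct a c S ∎
    where open ≡-Reasoning

  Pair : Set
  Pair = Path × Path

  IsIntervalʳ : ℕ → Pair → Set
  IsIntervalʳ n (r , t) = IsDMNʳ n r × IsDMNʳ n t × r ≤ʳ t

  attach-IsIntervalʳ : ∀ n {a c S b d T} → NoHeadD S → NoHeadD T →
    (IsIntervalʳ (suc n) (reduct a c S , reduct b d T) × a ≤ b × (c ≡ 0 → d ≡ 0))
      ⇔ IsIntervalʳ (suc (suc n)) (attach a c S , attach b d T)
  attach-IsIntervalʳ n {a} {c} {S} {b} {d} {T} h h′ = mk⇔
    (λ ((dr , dt , r≤t) , a≤b , c≡0⇒d≡0) →
      Equivalence.to (attach-IsDMNʳ (suc n) a c S) dr , Equivalence.to (attach-IsDMNʳ (suc n) b d T) dt ,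
      attach-≤ʳ⁺ h h′ r≤t a≤b c≡0⇒d≡0)
    (λ (dr , dt , r≤t) →
      let dr′ = Equivalence.from (attach-IsDMNʳ (suc n) a c S) dr
          pos = ≤-trans (s≤s z≤n) (subst (m ≤_) (leadingD-Ds-++ (a + c) h) (IsDMNʳ-leadingD n _ dr′))
          (r′≤t′ , a≤b , c≡0⇒d≡0) = attach-≤ʳ⁻ h h′ pos r≤t
      in (dr′ , Equivalence.from (attach-IsDMNʳ (suc n) b d T) dt , r′≤t′) , a≤b , c≡0⇒d≡0)

  attachStep : Pair → Point → Pair
  attachStep (r , t) s = attach (leadingD r ∸ lowerDepth s) (lowerDepth s) (dropD r) ,
                         attach (leadingD t ∸ upperDepth s) (upperDepth s) (dropD t)

  build : Pair → List Point → Pair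
  build = foldl attachStep

  stepsOf : ℕ → Pair → List Point
  stepsOf zero    _       = []
  stepsOf (suc k) (r , t) = stepsOf k (detach r , detach t) ∷ʳ step (depth r) (depth t)

  attachStep-reduct : ∀ a c S b d T → NoHeadD S → NoHeadD T →
    attachStep (reduct a c S , reduct b d T) (step c d) ≡ (attach a c S , attach b d T)
  attachStep-reduct a c S b d T h h′ =
    cong₂ _,_ (reattach a c S (lowerDepth-step c d) h) (reattach b d T (upperDepth-step c d) h′)
    where
    reattach : ∀ a c S {x} → x ≡ c → NoHeadD S →
      attach (leadingD (reduct a c S) ∸ x) x (dropD (reduct a c S)) ≡ attach a c S
    reattach a c S refl h = cong₂ (λ x y → attach x c y)
      (trans (cong (_∸ c) (leadingD-Ds-++ (a + c) h)) (m+n∸n≡m a c)) (dropD-Ds-++ (a + c) h)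

  stepsOf-attach : ∀ k a c S b d T → NoHeadD S → NoHeadD T →
    stepsOf (suc k) (attach a c S , attach b d T) ≡ stepsOf k (reduct a c S , reduct b d T) ∷ʳ step c d
  stepsOf-attach k a c S b d T h h′ = cong₂ (λ p s → stepsOf k p ∷ʳ s)
    (cong₂ _,_ (detach-attach a c S h) (detach-attach b d T h′))
    (cong₂ step (cong proj₁ (depthAndTail-attach a c S h)) (cong proj₁ (depthAndTail-attach b d T h′)))

  FinalDescents : ℕ → ℕ → Pair → Set
  FinalDescents i j (r , t) = leadingD r ≡ m + i × leadingD t ≡ m + i + j

  IntervalAt : ℕ → ℕ → ℕ → Pair → Set
  IntervalAt k i j p = IsIntervalʳ (suc k) p × FinalDescents i j p

  attachStep-IntervalAt : ∀ {k i j p s i′ j′} → IntervalAt k i j p → InS m s →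
    (+ i , + j) ⊕ s ≡ (+ i′ , + j′) →
    IntervalAt (suc k) i′ j′ (attachStep p s) × stepsOf (suc k) (attachStep p s) ≡ stepsOf k p ∷ʳ s
  attachStep-IntervalAt {k} {i} {j} {r , t} {s} {i′} {j′} (I , lr , lt) ins e =
    subst (λ q → IntervalAt (suc k) i′ j′ q × stepsOf (suc k) q ≡ stepsOf k (r , t) ∷ʳ s) (sym p≡)
      ((Equivalence.to (attach-IsIntervalʳ k h h′)
          (subst (IsIntervalʳ (suc k)) rt≡ I , m≤m+n i′ j′ , InS-depths ins) ,
        leadingD-Ds-++ (m + i′) tt , trans (leadingD-Ds-++ (m + (i′ + j′)) tt) (sym (+-assoc m i′ j′))) ,
       trans (stepsOf-attach k i′ c S (i′ + j′) d S′ h h′)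
             (cong₂ (λ q x → stepsOf k q ∷ʳ x) (sym rt≡) (sym s≡)))
    where
    c d : ℕ
    c = lowerDepth s
    d = upperDepth s
    S S′ : Path
    S = dropD r
    S′ = dropD t
    h : NoHeadD S
    h = dropD-NoHeadD r
    h′ : NoHeadD S′
    h′ = dropD-NoHeadD t
    s≡ : s ≡ step c d
    s≡ = InS⇒step ins
    eqs : i′ + c ≡ m + i × j′ + d ≡ c + j
    eqs = Equivalence.to (⊕-step i j c d i′ j′) (subst (λ x → (+ i , + j) ⊕ x ≡ (+ i′ , + j′)) s≡ e)
    leading-t : m + i + j ≡ i′ + j′ + d
    leading-t = begin
      m + i + j       ≡⟨ cong (_+ j) (proj₁ eqs) ⟨
      i′ + c + j      ≡⟨ +-assoc i′ c j ⟩
      i′ + (c + j)    ≡⟨ cong (λ x → i′ + x) (proj₂ eqs) ⟨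
      i′ + (j′ + d)   ≡⟨ +-assoc i′ j′ d ⟨
      i′ + j′ + d     ∎
      where open ≡-Reasoning
    rt≡ : (r , t) ≡ (reduct i′ c S , reduct (i′ + j′) d S′)
    rt≡ = cong₂ _,_ (trans (Ds-leadingD-dropD r) (cong (λ x → Ds x ++ S) (trans lr (sym (proj₁ eqs)))))
                    (trans (Ds-leadingD-dropD t) (cong (λ x → Ds x ++ S′) (trans lt leading-t)))
    p≡ : attachStep (r , t) s ≡ (attach i′ c S , attach (i′ + j′) d S′)
    p≡ = trans (cong₂ attachStep rt≡ s≡) (attachStep-reduct i′ c S (i′ + j′) d S′ h h′)

  IsWalkTo : ℕ → List Point → ℕ → ℕ → Set
  IsWalkTo k ss i j = length ss ≡ k × All (InS m) ss × StaysIn origin ss × endFrom origin ss ≡ (+ i , + j)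

  IsWalkTo-∷ʳ : ∀ {k ss i j s i′ j′} → IsWalkTo k ss i j → InS m s →
    (+ i , + j) ⊕ s ≡ (+ i′ , + j′) → IsWalkTo (suc k) (ss ∷ʳ s) i′ j′
  IsWalkTo-∷ʳ {k} {ss} {i} {j} {s} (len , all , stays , end) ins e =
    trans (length-++ ss) (trans (cong (_+ 1) len) (+-comm k 1)) ,
    ++⁺ all (ins ∷ []) ,
    StaysIn-++ origin ss [ s ] stays (subst (λ p → StaysIn p [ s ]) (sym end) (nonneg , tt)) ,
    trans (endFrom-++ origin ss [ s ]) (trans (cong (_⊕ s) end) e)
    where
    nonneg : 0ℤ ℤ.≤ proj₁ ((+ i , + j) ⊕ s) × 0ℤ ℤ.≤ proj₂ ((+ i , + j) ⊕ s)
    nonneg = subst (λ x → 0ℤ ℤ.≤ proj₁ x × 0ℤ ℤ.≤ proj₂ x) (sym e) (ℤ.+≤+ z≤n , ℤ.+≤+ z≤n)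

  build-IntervalAt : ∀ ss {k i j p} → IntervalAt k i j p → All (InS m) ss → StaysIn (+ i , + j) ss →
    ∃₂ λ i′ j′ → endFrom (+ i , + j) ss ≡ (+ i′ , + j′) ×
      IntervalAt (k + length ss) i′ j′ (build p ss) × stepsOf (k + length ss) (build p ss) ≡ stepsOf k p ++ ss
  build-IntervalAt [] {k} {i} {j} {p} I [] tt =
    i , j , refl , subst (λ n → IntervalAt n i j p) (sym (+-identityʳ k)) I ,
    trans (cong (λ n → stepsOf n p) (+-identityʳ k)) (sym (++-identityʳ _))
  build-IntervalAt (s ∷ ss) {k} {i} {j} {p} I (ins ∷ all) ((0≤x , 0≤y) , stays) =
    let I₁ , steps₁ = attachStep-IntervalAt I ins pos≡
        i′ , j′ , end , I′ , steps′ = build-IntervalAt ss I₁ all (subst (λ q → StaysIn q ss) pos≡ stays)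
    in i′ , j′ , trans (cong (λ q → endFrom q ss) pos≡) end ,
       subst (λ n → IntervalAt n i′ j′ (build (attachStep p s) ss)) (sym (+-suc k (length ss))) I′ ,
       (begin
         stepsOf (k + suc (length ss)) (build (attachStep p s) ss)
           ≡⟨ cong (λ n → stepsOf n (build (attachStep p s) ss)) (+-suc k (length ss)) ⟩
         stepsOf (suc k + length ss) (build (attachStep p s) ss)
           ≡⟨ steps′ ⟩
         stepsOf (suc k) (attachStep p s) ++ ss
           ≡⟨ cong (_++ ss) steps₁ ⟩
         (stepsOf k p ∷ʳ s) ++ ss
           ≡⟨ ++-assoc (stepsOf k p) [ s ] ss ⟩
         stepsOf k p ++ s ∷ ss ∎)
    where
    open ≡-Reasoning
    pos≡ : (+ i , + j) ⊕ s ≡ (+ ℤ.∣ proj₁ ((+ i , + j) ⊕ s) ∣ , + ℤ.∣ proj₂ ((+ i , + j) ⊕ s) ∣)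
    pos≡ = cong₂ _,_ (sym (ℤ.0≤i⇒+∣i∣≡i 0≤x)) (sym (ℤ.0≤i⇒+∣i∣≡i 0≤y))

  basePair : Pair
  basePair = base , base

  basePair-IntervalAt : IntervalAt 0 0 0 basePair
  basePair-IntervalAt = (base-IsDMNʳ , base-IsDMNʳ , ε) , leadingD-Ds-++ (m + 0) tt ,
    trans (leadingD-Ds-++ (m + 0) tt) (sym (+-identityʳ (m + 0)))

  IsIntervalʳ⇒walk : ∀ k {p} → IsIntervalʳ (suc k) p →
    ∃₂ λ i j → FinalDescents i j p × IsWalkTo k (stepsOf k p) i j × build basePair (stepsOf k p) ≡ p
  IsIntervalʳ⇒walk zero {r , t} (dr , dt , _) with IsDMNʳ-1 r dr | IsDMNʳ-1 t dt
  ... | refl | refl = 0 , 0 , proj₂ basePair-IntervalAt , (refl , [] , tt , refl) , refl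
  IsIntervalʳ⇒walk (suc k) {r , t} (dr , dt , r≤t)
    with IsDMNʳ⇒Attached (suc k) r dr | IsDMNʳ⇒Attached (suc k) t dt
  ... | a , c , S , h , refl | b , d , S′ , h′ , refl
    with Equivalence.from (attach-IsIntervalʳ k h h′) (dr , dt , r≤t)
  ... | I , a≤b , c≡0⇒d≡0 with m≤n⇒∃[o]m+o≡n a≤b | IsIntervalʳ⇒walk k I
  ... | e , refl | i , j , (lr , lt) , walk , built =
    a , e , (leadingD-Ds-++ (m + a) tt , trans (leadingD-Ds-++ (m + (a + e)) tt) (sym (+-assoc m a e))) ,
    subst (λ ss → IsWalkTo (suc k) ss a e) (sym steps≡) (IsWalkTo-∷ʳ walk (step-InS c d c≡0⇒d≡0) pos≡) ,
    (begin
      build basePair (stepsOf (suc k) (attach a c S , attach (a + e) d S′))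
        ≡⟨ cong (build basePair) steps≡ ⟩
      build basePair (stepsOf k (reduct a c S , reduct (a + e) d S′) ∷ʳ step c d)
        ≡⟨ foldl-++ attachStep basePair (stepsOf k _) [ step c d ] ⟩
      attachStep (build basePair (stepsOf k (reduct a c S , reduct (a + e) d S′))) (step c d)
        ≡⟨ cong (λ q → attachStep q (step c d)) built ⟩
      attachStep (reduct a c S , reduct (a + e) d S′) (step c d)
        ≡⟨ attachStep-reduct a c S (a + e) d S′ h h′ ⟩
      (attach a c S , attach (a + e) d S′) ∎)
    where
    open ≡-Reasoning
    steps≡ : stepsOf (suc k) (attach a c S , attach (a + e) d S′)
           ≡ stepsOf k (reduct a c S , reduct (a + e) d S′) ∷ʳ step c d
    steps≡ = stepsOf-attach k a c S (a + e) d S′ h h′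
    a+c≡m+i : a + c ≡ m + i
    a+c≡m+i = trans (sym (leadingD-Ds-++ (a + c) h)) lr
    e+d≡c+j : e + d ≡ c + j
    e+d≡c+j = +-cancelˡ-≡ a _ _ (begin
      a + (e + d)     ≡⟨ +-assoc a e d ⟨
      a + e + d       ≡⟨ leadingD-Ds-++ (a + e + d) h′ ⟨
      leadingD (reduct (a + e) d S′) ≡⟨ lt ⟩
      m + i + j       ≡⟨ cong (_+ j) a+c≡m+i ⟨
      a + c + j       ≡⟨ +-assoc a c j ⟩
      a + (c + j)     ∎)
    pos≡ : (+ i , + j) ⊕ step c d ≡ (+ a , + e)
    pos≡ = Equivalence.from (⊕-step i j c d a e) (a+c≡m+i , e+d≡c+j)

  reversePair : Pair → Pair
  reversePair (r , t) = reverse r , reverse t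

  reversePair-involutive : ∀ p → reversePair (reversePair p) ≡ p
  reversePair-involutive (r , t) = cong₂ _,_ (reverse-involutive r) (reverse-involutive t)

  intervalPair : ∀ n → Interval m n → Pair
  intervalPair n I = lowerPath {m} {n} I , upperPath {m} {n} I

  Interval⇒IsIntervalʳ : ∀ n (I : Interval m n) → IsIntervalʳ n (reversePair (intervalPair n I))
  Interval⇒IsIntervalʳ n ((P , dP) , (Q , dQ) , P≤Q) = unreverse P dP , unreverse Q dQ , ≤D⇒≤ʳ P≤Q
    where
    unreverse : ∀ P → IsDyck (m * n) P × All (m ∣_) (upRuns P) → IsDMNʳ n (reverse P)
    unreverse P = subst (λ q → IsDyck (m * n) q × All (m ∣_) (upRuns q)) (sym (reverse-involutive P))

  IsWalkTo⇒Walk : ∀ {k ss} → (∃₂ λ i j → IsWalkTo k ss i j) → Walk m k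
  IsWalkTo⇒Walk {ss = ss} (_ , _ , len , all , stays , _) = ss , len , all , stays

  Walk⇒IsWalkTo : ∀ {k} (w : Walk m k) → ∃₂ λ i j → IsWalkTo k (proj₁ w) i j
  Walk⇒IsWalkTo (ss , len , all , stays) with StaysIn-endFrom ss (ℤ.+≤+ z≤n) (ℤ.+≤+ z≤n) stays
  ... | 0≤x , 0≤y =
    _ , _ , len , all , stays , cong₂ _,_ (sym (ℤ.0≤i⇒+∣i∣≡i 0≤x)) (sym (ℤ.0≤i⇒+∣i∣≡i 0≤y))

  walk-IntervalAt : ∀ k (w : Walk m k) → ∃₂ λ i j → endpoint w ≡ (+ i , + j) ×
    IntervalAt k i j (build basePair (proj₁ w)) × stepsOf k (build basePair (proj₁ w)) ≡ proj₁ w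
  walk-IntervalAt _ (ss , refl , all , stays) = build-IntervalAt ss basePair-IntervalAt all stays

  build-IsIntervalʳ : ∀ k (w : Walk m k) → IsIntervalʳ (suc k) (build basePair (proj₁ w))
  build-IsIntervalʳ k w with walk-IntervalAt k w
  ... | _ , _ , _ , (I , _) , _ = I

  stepsOf-build : ∀ k (w : Walk m k) → stepsOf k (build basePair (proj₁ w)) ≡ proj₁ w
  stepsOf-build k w with walk-IntervalAt k w
  ... | _ , _ , _ , _ , steps = steps

  stepsOf-IsWalkTo : ∀ k {p} → IsIntervalʳ (suc k) p → ∃₂ λ i j → IsWalkTo k (stepsOf k p) i j
  stepsOf-IsWalkTo k I with IsIntervalʳ⇒walk k I
  ... | i , j , _ , walk , _ = i , j , walk

  build-stepsOf : ∀ k {p} → IsIntervalʳ (suc k) p → build basePair (stepsOf k p) ≡ p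
  build-stepsOf k I with IsIntervalʳ⇒walk k I
  ... | _ , _ , _ , _ , built = built

  walk⇒interval : ∀ k → Walk m k → Interval m (suc k)
  walk⇒interval k w =
    let dr , dt , r≤t = build-IsIntervalʳ k w
    in (reverse (proj₁ (build basePair (proj₁ w))) , dr) , (reverse (proj₂ (build basePair (proj₁ w))) , dt) ,
       ≤ʳ⇒≤D r≤t

  interval⇒walk : ∀ k → Interval m (suc k) → Walk m k
  interval⇒walk k I = IsWalkTo⇒Walk (stepsOf-IsWalkTo k (Interval⇒IsIntervalʳ (suc k) I))

  interval⇒walk∘walk⇒interval : ∀ k w → proj₁ (interval⇒walk k (walk⇒interval k w)) ≡ proj₁ w
  interval⇒walk∘walk⇒interval k w =
    trans (cong (stepsOf k) (reversePair-involutive (build basePair (proj₁ w)))) (stepsOf-build k w)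

  walk⇒interval∘interval⇒walk : ∀ k I →
    intervalPair (suc k) (walk⇒interval k (interval⇒walk k I)) ≡ intervalPair (suc k) I
  walk⇒interval∘interval⇒walk k I =
    trans (cong reversePair (build-stepsOf k (Interval⇒IsIntervalʳ (suc k) I)))
          (reversePair-involutive (intervalPair (suc k) I))

  walk↔interval : ∀ k → Inverse (WalkSetoid m k) (IntervalSetoid m (suc k))
  walk↔interval k = keyedInverse (walk⇒interval k) (interval⇒walk k)
    (cong (λ ss → reversePair (build basePair ss))) (cong (λ p → stepsOf k (reversePair p)))
    (walk⇒interval∘interval⇒walk k) (interval⇒walk∘walk⇒interval k)

  walk⇒interval-finalDescent : ∀ k (w : Walk m k) i j → endpoint w ≡ (+ i , + j) →
    finalDescent (lowerPath {m} {suc k} (walk⇒interval k w)) ≡ m + i ×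
    finalDescent (upperPath {m} {suc k} (walk⇒interval k w)) ≡ m + i + j
  walk⇒interval-finalDescent k w i j e with walk-IntervalAt k w
  ... | i′ , j′ , e′ , (_ , lr , lt) , _ with trans (sym e′) e
  ... | refl = trans (cong leadingD (reverse-involutive _)) lr , trans (cong leadingD (reverse-involutive _)) lt

  returnStep-InS : ∀ i j → InS m (negate (+ i , + j))
  returnStep-InS i j = inj₂ (ℤ.≤-<-trans (ℤ.neg-≤-pos {i} {0}) (ℤ.+<+ (s≤s z≤n)) ,
    subst (ℤ._≤ + m) (trans (cong ℤ.-_ (ℤ.pos-+ i j)) (ℤ.neg-distrib-+ (+ i) (+ j)))
          (ℤ.neg-≤-pos {i + j} {m}))

  close : List Point → List Point
  close ss = ss ∷ʳ negate (endFrom origin ss)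

  close-IsWalkTo : ∀ {k ss} → (∃₂ λ i j → IsWalkTo k ss i j) → IsWalkTo (suc k) (close ss) 0 0
  close-IsWalkTo {k} {ss} (i , j , W@(_ , _ , _ , end)) =
    subst (λ e → IsWalkTo (suc k) (ss ∷ʳ negate e) 0 0) (sym end)
          (IsWalkTo-∷ʳ W (returnStep-InS i j) (⊕-negate (+ i , + j)))

  walk⇒closedWalk : ∀ k → Walk m k → ClosedWalk m (suc k)
  walk⇒closedWalk k w = IsWalkTo⇒Walk (0 , 0 , W) , proj₂ (proj₂ (proj₂ W))
    where
    W : IsWalkTo (suc k) (close (proj₁ w)) 0 0
    W = close-IsWalkTo (Walk⇒IsWalkTo w)

  dropLast-Walk : ∀ {k} ss → length ss ≡ suc k → All (InS m) ss → StaysIn origin ss →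
    length (dropLast ss) ≡ k × All (InS m) (dropLast ss) × StaysIn origin (dropLast ss)
  dropLast-Walk ss len all stays with initLast ss
  dropLast-Walk .(ys ∷ʳ x) len all stays | ys ∷ʳ′ x rewrite dropLast-∷ʳ ys x =
    suc-injective (trans (+-comm 1 (length ys)) (trans (sym (length-++ ys)) len)) ,
    ++⁻ˡ ys all , StaysIn-++⁻ˡ origin ys [ x ] stays

  closedWalk⇒walk : ∀ k → ClosedWalk m (suc k) → Walk m k
  closedWalk⇒walk k ((ss , len , all , stays) , _) = dropLast ss , dropLast-Walk ss len all stays

  close-dropLast : ∀ {k} ss → endFrom origin ss ≡ origin → length ss ≡ suc k → close (dropLast ss) ≡ ss
  close-dropLast ss end len with initLast ss
  close-dropLast .(ys ∷ʳ x) end len | ys ∷ʳ′ x rewrite dropLast-∷ʳ ys x =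
    cong (ys ∷ʳ_) (⊕≡origin⇒negate (endFrom origin ys) x (trans (sym (endFrom-++ origin ys [ x ])) end))

  walk↔closedWalk : ∀ k → Inverse (WalkSetoid m k) (ClosedWalkSetoid m (suc k))
  walk↔closedWalk k = keyedInverse (walk⇒closedWalk k) (closedWalk⇒walk k) (cong close) (cong dropLast)
    (λ (((ss , len , _) , end)) → close-dropLast ss end len) (λ (ss , _) → dropLast-∷ʳ ss _)

corollary4p3 : (m n : ℕ) → 1 ≤ m → 1 ≤ n →
    (Σ (Bijection (WalkSetoid m (n ∸ 1)) (IntervalSetoid m n)) λ φ →
    (w : Walk m (n ∸ 1)) (i j : ℕ) → endpoint w ≡ (+ i , + j) →
    finalDescent (lowerPath (Bijection.to φ w)) ≡ m + i
    × finalDescent (upperPath (Bijection.to φ w)) ≡ m + i + j)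
    × Bijection (IntervalSetoid m n) (ClosedWalkSetoid m n)
corollary4p3 (suc m′) (suc k) _ _ =
  (Inverse⇒Bijection (walk↔interval m′ k) , walk⇒interval-finalDescent m′ k) ,
  Inverse⇒Bijection (Compose.inverse (Symmetry.inverse (walk↔interval m′ k)) (walk↔closedWalk m′ k))
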